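{- For each $\sigma\in\{\mu,\mu_o,\mu_d,\mu_t\}$, there are no constants $a>0$ and $b$ such that $a\cdot\sigma(G)+b\le\sigma(G-x)$ holds for every connected graph $G$ and every vertex $x\in V(G)$ with $G-x$ connected.
   Context: All graphs are finite, simple and connected; $G-x$ is the graph obtained by deleting $x$ and its incident edges. For a connected graph $G$ and $X\subseteq V(G)$, two vertices $u,v$ are $X$-visible if there is a shortest $u,v$-path $P$ in $G$ with $V(P)\cap X\subseteq\{u,v\}$. $X$ is a mutual-visibility set if all $u,v\in X$ are $X$-visible; an outer mutual-visibility set if all $u\in X$, $v\in V(G)$ are $X$-visible; a dual mutual-visibility set if all $u,v$ with $u,v\in X$ or $u,v\in V(G)\setminus X$ are $X$-visible; a total mutual-visibility set if all $u,v\in V(G)$ are $X$-visible. $\mu(G),\mu_o(G),\mu_d(G),\mu_t(G)$ denote the maximum cardinalities of such sets, respectively.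
   Formalization: The constants $a>0$ and $b$ are taken in ℚ. -}

module Defs where

open import Data.Nat using (ℕ; zero; suc; _≤_)
open import Data.Fin using (Fin; punchIn)
open import Data.Fin.Subset using (Subset; _∈_; _∉_; ∣_∣)
open import Data.Bool using (Bool; true; false)
open import Data.List using (List; []; _∷_; length)
open import Data.List.Membership.Propositional using () renaming (_∈_ to _∈ₗ_)
open import Data.Product using (Σ; _×_; _,_)
open import Data.Sum using (_⊎_)
open import Data.Integer using (+_)
open import Data.Rational using (ℚ; _/_)
open import Relation.Binary.PropositionalEquality using (_≡_)

record Graph (n : ℕ) : Set where
  field
    adj    : Fin n → Fin n → Bool
    sym    : ∀ i j → adj i j ≡ adj j i
    irrefl : ∀ i → adj i i ≡ false
open Graph public

data Walk {n : ℕ} (G : Graph n) : Fin n → Fin n → Set where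
  stop : ∀ {u} → Walk G u u
  step : ∀ {u w v} → adj G u w ≡ true → Walk G w v → Walk G u v

len : ∀ {n} {G : Graph n} {u v} → Walk G u v → ℕ
len stop       = zero
len (step _ p) = suc (len p)

verts : ∀ {n} {G : Graph n} {u v} → Walk G u v → List (Fin n)
verts {u = u} stop       = u ∷ []
verts {u = u} (step _ p) = u ∷ verts p

-- a shortest u,v-walk (necessarily a shortest u,v-path)
IsShortest : ∀ {n} {G : Graph n} {u v} → Walk G u v → Set
IsShortest {G = G} {u} {v} P = ∀ (Q : Walk G u v) → len P ≤ len Q

Connected : ∀ {n} → Graph n → Set
Connected {n} G = (Σ (Fin n) λ _ → Fin n) × (∀ u v → Walk G u v)
-- (the first component just records n ≥ 1)

-- G - x : delete vertex x; vertices of G - x are identified with Fin n via punchIn x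
_-ᵥ_ : ∀ {n} → Graph (suc n) → Fin (suc n) → Graph n
adj    (G -ᵥ x) i j = adj G (punchIn x i) (punchIn x j)
sym    (G -ᵥ x) i j = sym G (punchIn x i) (punchIn x j)
irrefl (G -ᵥ x) i   = irrefl G (punchIn x i)

Visible : ∀ {n} → Graph n → Subset n → Fin n → Fin n → Set
Visible G X u v =
  Σ (Walk G u v) λ P → IsShortest P ×
    (∀ w → w ∈ₗ verts P → w ∈ X → (w ≡ u) ⊎ (w ≡ v))

data VisKind : Set where
  mutualVis outerVis dualVis totalVis : VisKind

IsVisSet : VisKind → ∀ {n} → Graph n → Subset n → Set
IsVisSet mutualVis G X = ∀ u v → u ∈ X → v ∈ X → Visible G X u v
IsVisSet outerVis  G X = ∀ u v → u ∈ X → Visible G X u v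
IsVisSet dualVis   G X = ∀ u v → ((u ∈ X × v ∈ X) ⊎ (u ∉ X × v ∉ X)) → Visible G X u v
IsVisSet totalVis  G X = ∀ u v → Visible G X u v

IsVisNumber : VisKind → ∀ {n} → Graph n → ℕ → Set
IsVisNumber σ {n} G k =
  (Σ (Subset n) λ X → IsVisSet σ G X × ∣ X ∣ ≡ k) ×
  (∀ (X : Subset n) → IsVisSet σ G X → ∣ X ∣ ≤ k)

ℕtoℚ : ℕ → ℚ
ℕtoℚ k = (+ k) / 1

module Submission where

-- For m ≥ 3 the fan over the path P_m has σ = m for each of the four kinds:
-- the rim is a total mutual-visibility set, since two rim vertices are adjacent or
-- see each other through the apex, while the whole vertex set is not even a
-- mutual-visibility set. Deleting the apex leaves P_m, whose σ is 2: its two ends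
-- form a total mutual-visibility set, and of three vertices the middle one lies on
-- every walk between the other two. Hence a·m + b ≤ 2 for all m ≥ 3, which no a > 0
-- allows.

module Visibility where

  open import Defs hiding (sym)
  open import Data.Bool using (Bool; true; false)
  open import Data.Nat
  open import Data.Nat.Properties
  open import Data.Fin as Fin using (Fin; zero; suc; toℕ; fromℕ)
  open import Data.Fin.Properties using (toℕ-injective; toℕ≤pred[n]; toℕ-fromℕ)
  open import Data.Fin.Subset using (Subset; _∈_; _∉_; ∣_∣; ⊤; ⁅_⁆; inside; outside)
  open import Data.Fin.Subset.Properties
    using (∈⊤; ∣p∣≤n; ∣⊤∣≡n; ∣p∣≡n⇒p≡⊤; x∈⁅y⁆⇒x≡y; ∣⁅x⁆∣≡1)
  open import Data.Vec using (_∷_; here; there)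
  open import Data.List.Relation.Unary.Any using (here; there)
  open import Data.List.Membership.Propositional using () renaming (_∈_ to _∈ₗ_)
  open import Data.Product using (Σ; _×_; _,_; proj₂)
  open import Data.Sum using (_⊎_; inj₁; inj₂; swap)
  open import Relation.Nullary using (¬_; yes; no; contradiction)
  open import Relation.Binary.PropositionalEquality

  module _ {n : ℕ} (G : Graph n) where

    adjacent⇒≢ : ∀ {u v} → adj G u v ≡ true → u ≢ v
    adjacent⇒≢ {u} e refl with trans (sym e) (irrefl G u)
    ... | ()

    nonadjacent⇒2≤len : ∀ {u v} → u ≢ v → adj G u v ≡ false →
                        (Q : Walk G u v) → 2 ≤ len Q
    nonadjacent⇒2≤len u≢v _ stop = contradiction refl u≢v
    nonadjacent⇒2≤len _ f (step e stop) with trans (sym e) f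
    ... | ()
    nonadjacent⇒2≤len _ _ (step _ (step _ _)) = s≤s (s≤s z≤n)

    reverseOnto : ∀ {u v w} → Walk G u v → Walk G u w → Walk G v w
    reverseOnto stop acc = acc
    reverseOnto (step {u} {x} e p) acc = reverseOnto p (step (trans (Graph.sym G x u) e) acc)

    reverse : ∀ {u v} → Walk G u v → Walk G v u
    reverse p = reverseOnto p stop

    len-reverseOnto : ∀ {u v w} (p : Walk G u v) (acc : Walk G u w) →
                      len (reverseOnto p acc) ≡ len p + len acc
    len-reverseOnto stop acc = refl
    len-reverseOnto (step e p) acc = trans (len-reverseOnto p _) (+-suc (len p) (len acc))

    len-reverse : ∀ {u v} (p : Walk G u v) → len (reverse p) ≡ len p
    len-reverse p = trans (len-reverseOnto p stop) (+-identityʳ (len p))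

    source∈verts : ∀ {u v} (p : Walk G u v) → u ∈ₗ verts p
    source∈verts stop = here refl
    source∈verts (step _ _) = here refl

    ∈-verts-reverseOnto : ∀ {u v w z} (p : Walk G u v) (acc : Walk G u w) →
                          z ∈ₗ verts (reverseOnto p acc) → z ∈ₗ verts p ⊎ z ∈ₗ verts acc
    ∈-verts-reverseOnto stop acc z∈ = inj₂ z∈
    ∈-verts-reverseOnto (step e p) acc z∈ with ∈-verts-reverseOnto p _ z∈
    ... | inj₁ z∈p = inj₁ (there z∈p)
    ... | inj₂ (here refl) = inj₁ (there (source∈verts p))
    ... | inj₂ (there z∈acc) = inj₂ z∈acc

    ∈-verts-reverse : ∀ {u v z} (p : Walk G u v) → z ∈ₗ verts (reverse p) → z ∈ₗ verts p
    ∈-verts-reverse {u} p z∈ with ∈-verts-reverseOnto p stop z∈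
    ... | inj₁ z∈p = z∈p
    ... | inj₂ (here refl) = source∈verts p

    visible-refl : ∀ X u → Visible G X u u
    visible-refl X u = stop , (λ _ → z≤n) , λ { _ (here w≡u) _ → inj₁ w≡u }

    visible-adjacent : ∀ X {u v} → adj G u v ≡ true → Visible G X u v
    visible-adjacent X e = step e stop , shortest ,
      λ { _ (here w≡u) _ → inj₁ w≡u ; _ (there (here w≡v)) _ → inj₂ w≡v }
      where
      shortest : ∀ Q → 1 ≤ len Q
      shortest stop = contradiction refl (adjacent⇒≢ e)
      shortest (step _ _) = s≤s z≤n

    visible-via : ∀ X {u w v} → u ≢ v → adj G u v ≡ false →
                  adj G u w ≡ true → adj G w v ≡ true → w ∉ X → Visible G X u v
    visible-via X u≢v f e₁ e₂ w∉X = step e₁ (step e₂ stop) , nonadjacent⇒2≤len u≢v f ,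
      λ { _ (here z≡u) _ → inj₁ z≡u
        ; _ (there (here refl)) w∈X → contradiction w∈X w∉X
        ; _ (there (there (here z≡v))) _ → inj₂ z≡v }

    visible-sym : ∀ X {u v} → Visible G X u v → Visible G X v u
    visible-sym X (P , P-shortest , P-clear) = reverse P ,
      (λ Q → subst₂ _≤_ (sym (len-reverse P)) (len-reverse Q) (P-shortest (reverse Q))) ,
      λ z z∈ z∈X → swap (P-clear z (∈-verts-reverse P z∈) z∈X)

    ¬visible-⊤ : ∀ {u v} → u ≢ v → adj G u v ≡ false → ¬ Visible G ⊤ u v
    ¬visible-⊤ u≢v _ (stop , _) = u≢v refl
    ¬visible-⊤ _ f (step e stop , _) with trans (sym e) f
    ... | ()
    ¬visible-⊤ _ f (step {w = w} e (step _ _) , _ , P-clear) with P-clear w (there (here refl)) ∈⊤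
    ... | inj₁ refl = adjacent⇒≢ e refl
    ... | inj₂ refl with trans (sym e) f
    ...   | ()

  visSet⇒mutual : ∀ σ {n} {G : Graph n} {X} → IsVisSet σ G X → IsVisSet mutualVis G X
  visSet⇒mutual mutualVis S = S
  visSet⇒mutual outerVis S u v u∈X _ = S u v u∈X
  visSet⇒mutual dualVis S u v u∈X v∈X = S u v (inj₁ (u∈X , v∈X))
  visSet⇒mutual totalVis S u v _ _ = S u v

  total⇒visSet : ∀ σ {n} {G : Graph n} {X} → IsVisSet totalVis G X → IsVisSet σ G X
  total⇒visSet mutualVis T u v _ _ = T u v
  total⇒visSet outerVis T u v _ = T u v
  total⇒visSet dualVis T u v _ = T u v
  total⇒visSet totalVis T = T

  -- Every total mutual-visibility set is a σ-set and every σ-set is a mutual-visibility set.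
  isVisNumber-squeeze : ∀ σ {n} {G : Graph n} {X k} → IsVisSet totalVis G X → ∣ X ∣ ≡ k →
                        (∀ Y → IsVisSet mutualVis G Y → ∣ Y ∣ ≤ k) → IsVisNumber σ G k
  isVisNumber-squeeze σ {X = X} T ∣X∣≡k bound =
    (X , total⇒visSet σ T , ∣X∣≡k) , λ Y S → bound Y (visSet⇒mutual σ S)

  cone : ∀ {m} → Graph m → Graph (suc m)
  adj (cone G) zero    zero    = false
  adj (cone G) zero    (suc _) = true
  adj (cone G) (suc _) zero    = true
  adj (cone G) (suc i) (suc j) = adj G i j
  Graph.sym (cone G) zero    zero    = refl
  Graph.sym (cone G) zero    (suc _) = refl
  Graph.sym (cone G) (suc _) zero    = refl
  Graph.sym (cone G) (suc i) (suc j) = Graph.sym G i j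
  irrefl (cone G) zero    = refl
  irrefl (cone G) (suc i) = irrefl G i

  rim : ∀ m → Subset (suc m)
  rim m = outside ∷ ⊤

  module _ {m : ℕ} (G : Graph m) where

    cone-connected : Connected (cone G)
    cone-connected = (zero , zero) , walk
      where
      walk : ∀ u v → Walk (cone G) u v
      walk zero    zero    = stop
      walk zero    (suc _) = step refl stop
      walk (suc _) zero    = step refl stop
      walk (suc _) (suc _) = step {w = zero} refl (step refl stop)

    cone-rim-total : IsVisSet totalVis (cone G) (rim m)
    cone-rim-total zero    zero    = visible-refl _ _ zero
    cone-rim-total zero    (suc _) = visible-adjacent _ _ refl
    cone-rim-total (suc _) zero    = visible-adjacent _ _ refl
    cone-rim-total (suc i) (suc j) with i Fin.≟ j | adj G i j in eq
    ... | yes refl | _     = visible-refl _ _ _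
    ... | no _     | true  = visible-adjacent _ _ eq
    ... | no i≢j   | false =
      visible-via (cone G) (rim m) {w = zero} (λ { refl → i≢j refl }) eq refl refl λ ()

    cone-mutual-bound : ∀ {u v} → u ≢ v → adj G u v ≡ false →
                        ∀ Y → IsVisSet mutualVis (cone G) Y → ∣ Y ∣ ≤ m
    cone-mutual-bound {u} {v} u≢v f Y S with m≤n⇒m<n∨m≡n (∣p∣≤n Y)
    ... | inj₁ ∣Y∣<1+m = s≤s⁻¹ ∣Y∣<1+m
    ... | inj₂ ∣Y∣≡1+m with refl ← ∣p∣≡n⇒p≡⊤ {p = Y} ∣Y∣≡1+m =
      contradiction (S (suc u) (suc v) ∈⊤ ∈⊤) (¬visible-⊤ (cone G) (λ { refl → u≢v refl }) f)

    cone-visNumber : ∀ σ {u v} → u ≢ v → adj G u v ≡ false → IsVisNumber σ (cone G) m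
    cone-visNumber σ u≢v f =
      isVisNumber-squeeze σ cone-rim-total (∣⊤∣≡n m) (cone-mutual-bound u≢v f)

  pathAdj : ℕ → ℕ → Bool
  pathAdj (suc a)    (suc b)    = pathAdj a b
  pathAdj zero       (suc zero) = true
  pathAdj (suc zero) zero       = true
  pathAdj _          _          = false

  pathAdj-sym : ∀ a b → pathAdj a b ≡ pathAdj b a
  pathAdj-sym zero          zero          = refl
  pathAdj-sym zero          (suc zero)    = refl
  pathAdj-sym zero          (suc (suc b)) = refl
  pathAdj-sym (suc zero)    zero          = refl
  pathAdj-sym (suc (suc a)) zero          = refl
  pathAdj-sym (suc a)       (suc b)       = pathAdj-sym a b

  pathAdj-irrefl : ∀ a → pathAdj a a ≡ false
  pathAdj-irrefl zero    = refl
  pathAdj-irrefl (suc a) = pathAdj-irrefl a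

  pathAdj⇒≤suc : ∀ a b → pathAdj a b ≡ true → b ≤ suc a
  pathAdj⇒≤suc zero       (suc zero) _ = ≤-refl
  pathAdj⇒≤suc (suc zero) zero       _ = z≤n
  pathAdj⇒≤suc (suc a)    (suc b)    e = s≤s (pathAdj⇒≤suc a b e)

  path : ∀ m → Graph m
  adj       (path m) i j = pathAdj (toℕ i) (toℕ j)
  Graph.sym (path m) i j = pathAdj-sym (toℕ i) (toℕ j)
  irrefl    (path m) i   = pathAdj-irrefl (toℕ i)

  path-reach : ∀ {m} {u v : Fin m} (Q : Walk (path m) u v) → toℕ v ≤ toℕ u + len Q
  path-reach {u = u} stop = m≤m+n (toℕ u) 0
  path-reach {u = u} {v} (step {w = w} e Q) = begin
    toℕ v                ≤⟨ path-reach Q ⟩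
    toℕ w + len Q        ≤⟨ +-monoˡ-≤ (len Q) (pathAdj⇒≤suc (toℕ u) (toℕ w) e) ⟩
    suc (toℕ u) + len Q  ≡⟨ +-suc (toℕ u) (len Q) ⟨
    toℕ u + suc (len Q)  ∎
    where open ≤-Reasoning

  path-between : ∀ {m} {i j l : Fin m} → toℕ i ≤ toℕ j → toℕ j ≤ toℕ l →
                 (Q : Walk (path m) i l) → j ∈ₗ verts Q
  path-between i≤j j≤l stop = here (toℕ-injective (≤-antisym j≤l i≤j))
  path-between {i = i} {j} i≤j j≤l (step {w = w} e Q) with toℕ i ≟ toℕ j
  ... | yes i≡j = here (toℕ-injective (sym i≡j))
  ... | no i≢j  = there (path-between w≤j j≤l Q)
    where
    w≤j : toℕ w ≤ toℕ j
    w≤j = ≤-trans (pathAdj⇒≤suc (toℕ i) (toℕ w) e) (≤∧≢⇒< i≤j i≢j)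

  shift : ∀ {m} {i j : Fin m} → Walk (path m) i j → Walk (path (suc m)) (suc i) (suc j)
  shift stop       = stop
  shift (step e p) = step e (shift p)

  len-shift : ∀ {m} {i j : Fin m} (p : Walk (path m) i j) → len (shift p) ≡ len p
  len-shift stop       = refl
  len-shift (step e p) = cong suc (len-shift p)

  ∈-verts-shift : ∀ {m} {i j : Fin m} {w} (p : Walk (path m) i j) → w ∈ₗ verts (shift p) →
                  Σ (Fin m) λ w′ → w ≡ suc w′ × w′ ∈ₗ verts p
  ∈-verts-shift stop       (here refl) = _ , refl , here refl
  ∈-verts-shift (step e p) (here refl) = _ , refl , here refl
  ∈-verts-shift (step e p) (there w∈) with ∈-verts-shift p w∈
  ... | w′ , w≡ , w′∈ = w′ , w≡ , there w′∈

  ascend : ∀ {m} (i j : Fin m) → toℕ i ≤ toℕ j → Walk (path m) i j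
  ascend zero    zero    _         = stop
  ascend {suc zero}    zero (suc ()) _
  ascend {suc (suc m)} zero (suc j) _ = step refl (shift (ascend zero j z≤n))
  ascend (suc i) (suc j) (s≤s i≤j) = shift (ascend i j i≤j)

  len-ascend : ∀ {m} (i j : Fin m) (i≤j : toℕ i ≤ toℕ j) →
               toℕ i + len (ascend i j i≤j) ≡ toℕ j
  len-ascend zero    zero    _         = refl
  len-ascend {suc zero}    zero (suc ()) _
  len-ascend {suc (suc m)} zero (suc j) _ = cong suc (trans (len-shift _) (len-ascend zero j z≤n))
  len-ascend (suc i) (suc j) (s≤s i≤j) =
    cong suc (trans (cong (toℕ i +_) (len-shift _)) (len-ascend i j i≤j))

  ascend-shortest : ∀ {m} (i j : Fin m) (i≤j : toℕ i ≤ toℕ j) → IsShortest (ascend i j i≤j)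
  ascend-shortest i j i≤j Q =
    +-cancelˡ-≤ (toℕ i) _ _ (subst (_≤ toℕ i + len Q) (sym (len-ascend i j i≤j)) (path-reach Q))

  ∈-verts-ascend : ∀ {m} (i j : Fin m) (i≤j : toℕ i ≤ toℕ j) {w} →
                   w ∈ₗ verts (ascend i j i≤j) →
                   toℕ i ≤ toℕ w × toℕ w ≤ toℕ j
  ∈-verts-ascend zero zero _ (here refl) = z≤n , z≤n
  ∈-verts-ascend {suc zero}    zero (suc ()) _
  ∈-verts-ascend {suc (suc m)} zero (suc j) _ (here refl) = z≤n , z≤n
  ∈-verts-ascend {suc (suc m)} zero (suc j) _ (there w∈) with ∈-verts-shift _ w∈
  ... | w′ , refl , w′∈ = z≤n , s≤s (proj₂ (∈-verts-ascend zero j z≤n w′∈))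
  ∈-verts-ascend (suc i) (suc j) (s≤s i≤j) w∈ with ∈-verts-shift _ w∈
  ... | w′ , refl , w′∈ with ∈-verts-ascend i j i≤j w′∈
  ... | i≤w′ , w′≤j = s≤s i≤w′ , s≤s w′≤j

  path-connected : ∀ s → Connected (path (suc s))
  path-connected s = (zero , zero) , walk
    where
    walk : ∀ u v → Walk (path (suc s)) u v
    walk u v with toℕ u ≤? toℕ v
    ... | yes u≤v = ascend u v u≤v
    ... | no u≰v  = reverse (path (suc s)) (ascend v u (<⇒≤ (≰⇒> u≰v)))

  ends : ∀ s → Subset (suc (suc s))
  ends s = inside ∷ ⁅ fromℕ s ⁆

  ∈-ends : ∀ s {w} → w ∈ ends s → w ≡ zero ⊎ toℕ w ≡ suc s
  ∈-ends s here = inj₁ refl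
  ∈-ends s (there w∈) =
    inj₂ (cong suc (trans (cong toℕ (x∈⁅y⁆⇒x≡y (fromℕ s) w∈)) (toℕ-fromℕ s)))

  path-ends-visible-ascending : ∀ s (u v : Fin (suc (suc s))) → toℕ u ≤ toℕ v →
                                Visible (path (suc (suc s))) (ends s) u v
  path-ends-visible-ascending s u v u≤v =
    ascend u v u≤v , ascend-shortest u v u≤v ,
    λ w w∈ w∈ends → ends-are-endpoints (∈-verts-ascend u v u≤v w∈) (∈-ends s w∈ends)
    where
    ends-are-endpoints : ∀ {w} → toℕ u ≤ toℕ w × toℕ w ≤ toℕ v →
                         w ≡ zero ⊎ toℕ w ≡ suc s → w ≡ u ⊎ w ≡ v
    ends-are-endpoints (u≤w , _) (inj₁ refl) = inj₁ (toℕ-injective (sym (n≤0⇒n≡0 u≤w)))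
    ends-are-endpoints (_ , w≤v) (inj₂ w≡1+s) =
      inj₂ (toℕ-injective (≤-antisym w≤v (≤-trans (toℕ≤pred[n] v) (≤-reflexive (sym w≡1+s)))))

  path-ends-total : ∀ s → IsVisSet totalVis (path (suc (suc s))) (ends s)
  path-ends-total s u v with toℕ u ≤? toℕ v
  ... | yes u≤v = path-ends-visible-ascending s u v u≤v
  ... | no u≰v  = visible-sym _ _ (path-ends-visible-ascending s v u (<⇒≤ (≰⇒> u≰v)))

  member : ∀ {m} (Y : Subset m) → 1 ≤ ∣ Y ∣ → Σ (Fin m) (_∈ Y)
  member (inside  ∷ Y) _ = zero , here
  member (outside ∷ Y) 1≤∣Y∣ with member Y 1≤∣Y∣
  ... | i , i∈Y = suc i , there i∈Y

  increasing-pair : ∀ {m} (Y : Subset m) → 2 ≤ ∣ Y ∣ →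
                    Σ (Fin m) λ i → Σ (Fin m) λ j → toℕ i < toℕ j × i ∈ Y × j ∈ Y
  increasing-pair (inside ∷ Y) (s≤s 1≤∣Y∣) with member Y 1≤∣Y∣
  ... | i , i∈Y = zero , suc i , s≤s z≤n , here , there i∈Y
  increasing-pair (outside ∷ Y) 2≤∣Y∣ with increasing-pair Y 2≤∣Y∣
  ... | i , j , i<j , i∈Y , j∈Y = suc i , suc j , s≤s i<j , there i∈Y , there j∈Y

  increasing-triple : ∀ {m} (Y : Subset m) → 3 ≤ ∣ Y ∣ →
                      Σ (Fin m) λ i → Σ (Fin m) λ j → Σ (Fin m) λ l →
                      toℕ i < toℕ j × toℕ j < toℕ l × i ∈ Y × j ∈ Y × l ∈ Y
  increasing-triple (inside ∷ Y) (s≤s 2≤∣Y∣) with increasing-pair Y 2≤∣Y∣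
  ... | i , j , i<j , i∈Y , j∈Y =
    zero , suc i , suc j , s≤s z≤n , s≤s i<j , here , there i∈Y , there j∈Y
  increasing-triple (outside ∷ Y) 3≤∣Y∣ with increasing-triple Y 3≤∣Y∣
  ... | i , j , l , i<j , j<l , i∈Y , j∈Y , l∈Y =
    suc i , suc j , suc l , s≤s i<j , s≤s j<l , there i∈Y , there j∈Y , there l∈Y

  path-mutual-bound : ∀ {m} Y → IsVisSet mutualVis (path m) Y → ∣ Y ∣ ≤ 2
  path-mutual-bound Y S with ∣ Y ∣ ≤? 2
  ... | yes ∣Y∣≤2 = ∣Y∣≤2
  ... | no ∣Y∣≰2 with increasing-triple Y (≰⇒> ∣Y∣≰2)
  ... | i , j , l , i<j , j<l , i∈Y , j∈Y , l∈Y with S i l i∈Y l∈Y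
  ... | P , _ , P-clear with P-clear j (path-between (<⇒≤ i<j) (<⇒≤ j<l) P) j∈Y
  ... | inj₁ refl = contradiction i<j (<-irrefl refl)
  ... | inj₂ refl = contradiction j<l (<-irrefl refl)

  path-visNumber : ∀ σ s → IsVisNumber σ (path (suc (suc s))) 2
  path-visNumber σ s =
    isVisNumber-squeeze σ (path-ends-total s) (cong suc (∣⁅x⁆∣≡1 (fromℕ s))) path-mutual-bound

module Archimedean where

  open import Defs using (ℕtoℚ)
  open import Data.Nat as ℕ using (ℕ; suc)
  import Data.Nat.Properties as ℕ
  open import Data.Integer as ℤ using (+_; -[1+_])
  import Data.Integer.Properties as ℤ
  open import Data.Nat.Divisibility using (∣1⇒≡1)
  open import Data.Rational
  open import Data.Rational.Properties
  open import Data.Product using (_,_)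
  open import Relation.Nullary using (¬_)
  open import Relation.Binary.PropositionalEquality

  ℕtoℚ≡mkℚ : ∀ n → ℕtoℚ n ≡ mkℚ (+ n) 0 (λ { (_ , d∣1) → ∣1⇒≡1 d∣1 })
  ℕtoℚ≡mkℚ n = normalize-coprime _

  <ℕtoℚ : ∀ p {n} → ℤ.∣ ↥ p ∣ ℕ.< n → p < ℕtoℚ n
  <ℕtoℚ (mkℚ (+ k) d _) {n} k<n rewrite ℕtoℚ≡mkℚ n =
    *<* (subst₂ ℤ._<_ (sym (ℤ.*-identityʳ (+ k))) (ℤ.pos-* n (suc d))
      (ℤ.+<+ (ℕ.<-≤-trans k<n (ℕ.m≤m*n n (suc d)))))
  <ℕtoℚ (mkℚ -[1+ k ] d _) {n} _ rewrite ℕtoℚ≡mkℚ n =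
    *<* (subst₂ ℤ._<_ (sym (ℤ.*-identityʳ -[1+ k ])) (ℤ.pos-* n (suc d)) ℤ.-<+)

  x+y≤z⇒x≤z-y : ∀ {x y z} → x + y ≤ z → x ≤ z - y
  x+y≤z⇒x≤z-y {x} {y} {z} x+y≤z = subst (_≤ z - y) x+y-y≡x (+-monoˡ-≤ (- y) x+y≤z)
    where
    x+y-y≡x : x + y - y ≡ x
    x+y-y≡x = begin
      x + y - y     ≡⟨ +-assoc x y (- y) ⟩
      x + (y - y)   ≡⟨ cong (λ r → x + r) (+-inverseʳ y) ⟩
      x + 0ℚ        ≡⟨ +-identityʳ x ⟩
      x             ∎
      where open ≡-Reasoning

  affine-unbounded : ∀ {a} b c d → 0ℚ < a → ¬ (∀ t → a * ℕtoℚ (d ℕ.+ t) + b ≤ c)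
  affine-unbounded {a} b c d 0<a bounded = <-irrefl refl (<-≤-trans q<N N≤q)
    where
    instance
      a-positive : Positive a
      a-positive = positive 0<a
      a-nonZero : NonZero a
      a-nonZero = pos⇒nonZero a
    q : ℚ
    q = (c - b) * 1/ a
    N : ℕ
    N = d ℕ.+ suc ℤ.∣ ↥ q ∣
    q<N : q < ℕtoℚ N
    q<N = <ℕtoℚ q (ℕ.m≤n+m (suc ℤ.∣ ↥ q ∣) d)
    a*q≡c-b : a * q ≡ c - b
    a*q≡c-b = begin
      a * ((c - b) * 1/ a)  ≡⟨ *-comm a _ ⟩
      (c - b) * 1/ a * a    ≡⟨ *-assoc (c - b) (1/ a) a ⟩
      (c - b) * (1/ a * a)  ≡⟨ cong ((c - b) *_) (*-inverseˡ a) ⟩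
      (c - b) * 1ℚ          ≡⟨ *-identityʳ (c - b) ⟩
      c - b                 ∎
      where open ≡-Reasoning
    N≤q : ℕtoℚ N ≤ q
    N≤q = *-cancelˡ-≤-pos a
            (subst (a * ℕtoℚ N ≤_) (sym a*q≡c-b) (x+y≤z⇒x≤z-y (bounded (suc ℤ.∣ ↥ q ∣))))

open import Defs
open import Data.Nat as ℕ using (ℕ; suc)
open import Data.Fin using (Fin; zero; suc)
open import Data.Product using (Σ; _×_; _,_)
open import Data.Rational using (ℚ; 0ℚ; _+_; _*_; _≤_; _<_)
open import Relation.Nullary using (¬_)
open import Relation.Binary.PropositionalEquality using (refl)
open Visibility using (cone; cone-connected; cone-visNumber; path; path-connected; path-visNumber)
open Archimedean using (affine-unbounded)

-- cone (path m) -ᵥ zero is path m by definition.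
corollary5p2 : (σ : VisKind) →
    ¬ (Σ ℚ λ a → Σ ℚ λ b → (0ℚ < a) ×
        (∀ (n : ℕ) (G : Graph (suc n)) (x : Fin (suc n)) →
          Connected G → Connected (G -ᵥ x) →
          ∀ (k k′ : ℕ) → IsVisNumber σ G k → IsVisNumber σ (G -ᵥ x) k′ →
          a * ℕtoℚ k + b ≤ ℕtoℚ k′))
corollary5p2 σ (a , b , 0<a , bounded) = affine-unbounded b (ℕtoℚ 2) 3 0<a λ t →
  bounded (3 ℕ.+ t) (cone (path (3 ℕ.+ t))) zero
    (cone-connected _) (path-connected _) _ 2
    (cone-visNumber _ σ {u = zero} {v = suc (suc zero)} (λ ()) refl)
    (path-visNumber σ _)
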